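{- Let $\mathcal{C}$ be a partial cartesian closed category with equality. Then $\mathcal{C}$ has disjoint finite coproducts if and only if $\mathcal{C}$ has a (strict) initial object $0$, the coproduct $1+1$ exists in $\mathcal{C}$, and the monomorphism $0\to 1$ is regular.
   Context: A dominion on a category $\mathcal{C}$ is a class $\mathcal{M}$ of monomorphisms containing all identities, closed under composition, and stable under pullback. A partial morphism $X\rightharpoonup Y$ is a span $X\xleftarrow{m} D\xrightarrow{f} Y$ with $m\in\mathcal{M}$, modulo isomorphism of $D$; these form a category $\mathbf{P}(\mathcal{C},\mathcal{M})$ containing $\mathcal{C}$ via $f\mapsto(\mathrm{id},f)$. A cartesian category $\mathcal{C}$ with dominion $\mathcal{M}$ is a partial cartesian closed category if for each object $A$ the composite $\mathcal{C}\xrightarrow{ -\times A}\mathcal{C}\hookrightarrow\mathbf{P}(\mathcal{C},\mathcal{M})$ has a right adjoint; it is one with equality if $\mathcal{M}$ contains all diagonals (then $\mathcal{M}$ consists exactly of the regular monomorphisms). Coproducts are disjoint if the pullback of two distinct coproduct injections is the initial object. An initial object is strict if every morphism into it is an isomorphism. $1$ denotes the terminal object. -}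

module Defs where

open import Level using (Level; _⊔_) renaming (suc to lsuc)
open import Data.Product using (Σ; _×_; _,_; proj₁; proj₂; Σ-syntax)
open import Relation.Binary using (Rel; IsEquivalence)
open import Function.Bundles using (_⇔_)

record Category (o ℓ e : Level) : Set (lsuc (o ⊔ ℓ ⊔ e)) where
  infixr 9 _∘_
  infix 4 _≈_
  field
    Obj : Set o
    _⇒_ : Obj → Obj → Set ℓ
    _≈_ : ∀ {A B} → Rel (A ⇒ B) e
    id  : ∀ {A} → A ⇒ A
    _∘_ : ∀ {A B C} → B ⇒ C → A ⇒ B → A ⇒ C
    ≈-equiv : ∀ {A B} → IsEquivalence (_≈_ {A} {B})
    ∘-resp-≈ : ∀ {A B C} {f h : B ⇒ C} {g i : A ⇒ B} → f ≈ h → g ≈ i → f ∘ g ≈ h ∘ i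
    identityˡ : ∀ {A B} {f : A ⇒ B} → id ∘ f ≈ f
    identityʳ : ∀ {A B} {f : A ⇒ B} → f ∘ id ≈ f
    assoc : ∀ {A B C D} {f : A ⇒ B} {g : B ⇒ C} {h : C ⇒ D} →
            (h ∘ g) ∘ f ≈ h ∘ (g ∘ f)

module Notions {o ℓ e : Level} (C : Category o ℓ e) where
  open Category C

  Mono : ∀ {A B} → A ⇒ B → Set (o ⊔ ℓ ⊔ e)
  Mono {A} f = ∀ {X} (g h : X ⇒ A) → f ∘ g ≈ f ∘ h → g ≈ h

  IsIso : ∀ {A B} → A ⇒ B → Set (ℓ ⊔ e)
  IsIso {A} {B} f = Σ[ g ∈ B ⇒ A ] (g ∘ f ≈ id × f ∘ g ≈ id)

  IsTerminal : Obj → Set (o ⊔ ℓ ⊔ e)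
  IsTerminal T = ∀ X → Σ[ ! ∈ X ⇒ T ] (∀ (g : X ⇒ T) → g ≈ !)

  IsInitial : Obj → Set (o ⊔ ℓ ⊔ e)
  IsInitial I = ∀ X → Σ[ ¡ ∈ I ⇒ X ] (∀ (g : I ⇒ X) → g ≈ ¡)

  IsStrictInitial : Obj → Set (o ⊔ ℓ ⊔ e)
  IsStrictInitial I = IsInitial I × (∀ {X} (f : X ⇒ I) → IsIso f)

  IsPullback : ∀ {P A B Z} → P ⇒ A → P ⇒ B → A ⇒ Z → B ⇒ Z → Set (o ⊔ ℓ ⊔ e)
  IsPullback {P} {A} {B} p₁ p₂ f g =
    (f ∘ p₁ ≈ g ∘ p₂) ×
    (∀ {Q} (q₁ : Q ⇒ A) (q₂ : Q ⇒ B) → f ∘ q₁ ≈ g ∘ q₂ →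
      Σ[ u ∈ Q ⇒ P ] ((p₁ ∘ u ≈ q₁ × p₂ ∘ u ≈ q₂) ×
        (∀ (v : Q ⇒ P) → p₁ ∘ v ≈ q₁ → p₂ ∘ v ≈ q₂ → v ≈ u)))

  IsProduct : ∀ {P A B} → P ⇒ A → P ⇒ B → Set (o ⊔ ℓ ⊔ e)
  IsProduct {P} {A} {B} π₁ π₂ =
    ∀ {Q} (q₁ : Q ⇒ A) (q₂ : Q ⇒ B) →
      Σ[ u ∈ Q ⇒ P ] ((π₁ ∘ u ≈ q₁ × π₂ ∘ u ≈ q₂) ×
        (∀ (v : Q ⇒ P) → π₁ ∘ v ≈ q₁ → π₂ ∘ v ≈ q₂ → v ≈ u))

  IsCoproduct : ∀ {S A B} → A ⇒ S → B ⇒ S → Set (o ⊔ ℓ ⊔ e)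
  IsCoproduct {S} {A} {B} i₁ i₂ =
    ∀ {Q} (q₁ : A ⇒ Q) (q₂ : B ⇒ Q) →
      Σ[ u ∈ S ⇒ Q ] ((u ∘ i₁ ≈ q₁ × u ∘ i₂ ≈ q₂) ×
        (∀ (v : S ⇒ Q) → v ∘ i₁ ≈ q₁ → v ∘ i₂ ≈ q₂ → v ≈ u))

  IsEqualizer : ∀ {E A B} → E ⇒ A → A ⇒ B → A ⇒ B → Set (o ⊔ ℓ ⊔ e)
  IsEqualizer {E} {A} {B} m f g =
    (f ∘ m ≈ g ∘ m) ×
    (∀ {Q} (q : Q ⇒ A) → f ∘ q ≈ g ∘ q →
      Σ[ u ∈ Q ⇒ E ] ((m ∘ u ≈ q) × (∀ (v : Q ⇒ E) → m ∘ v ≈ q → v ≈ u)))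

  RegularMono : ∀ {E A} → E ⇒ A → Set (o ⊔ ℓ ⊔ e)
  RegularMono {E} {A} m = Σ[ B ∈ Obj ] Σ[ f ∈ A ⇒ B ] Σ[ g ∈ A ⇒ B ] IsEqualizer m f g

  record Cartesian : Set (o ⊔ ℓ ⊔ e) where
    infixr 7 _×ₒ_
    field
      ⊤ : Obj
      ⊤-terminal : IsTerminal ⊤
      _×ₒ_ : Obj → Obj → Obj
      π₁ : ∀ {A B} → (A ×ₒ B) ⇒ A
      π₂ : ∀ {A B} → (A ×ₒ B) ⇒ B
      product : ∀ {A B} → IsProduct (π₁ {A} {B}) π₂

    ⟨_,_⟩ : ∀ {Q A B} → Q ⇒ A → Q ⇒ B → Q ⇒ (A ×ₒ B)
    ⟨ f , g ⟩ = proj₁ (product f g)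

    _⁂_ : ∀ {A B C D} → A ⇒ B → C ⇒ D → (A ×ₒ C) ⇒ (B ×ₒ D)
    f ⁂ g = ⟨ f ∘ π₁ , g ∘ π₂ ⟩

    Δ : ∀ {A} → A ⇒ (A ×ₒ A)
    Δ = ⟨ id , id ⟩

  record Dominion (m : Level) : Set (o ⊔ ℓ ⊔ e ⊔ lsuc m) where
    field
      M : ∀ {A B} → A ⇒ B → Set m
      M-mono : ∀ {A B} {f : A ⇒ B} → M f → Mono f
      M-id : ∀ {A} → M (id {A})
      M-∘ : ∀ {A B C} {f : B ⇒ C} {g : A ⇒ B} → M f → M g → M (f ∘ g)
      pb-obj : ∀ {D A B} (n : D ⇒ B) → M n → (f : A ⇒ B) → Obj
      pb₁ : ∀ {D A B} (n : D ⇒ B) (Mn : M n) (f : A ⇒ B) → pb-obj n Mn f ⇒ A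
      pb₂ : ∀ {D A B} (n : D ⇒ B) (Mn : M n) (f : A ⇒ B) → pb-obj n Mn f ⇒ D
      pb-isPullback : ∀ {D A B} (n : D ⇒ B) (Mn : M n) (f : A ⇒ B) →
        IsPullback (pb₁ n Mn f) (pb₂ n Mn f) f n
      M-stable : ∀ {P D A B} {n : D ⇒ B} {f : A ⇒ B} {p₁ : P ⇒ A} {p₂ : P ⇒ D} →
        M n → IsPullback p₁ p₂ f n → M p₁

  module Partial {m : Level} (Dom : Dominion m) where
    open Dominion Dom

    record _⇀_ (X Y : Obj) : Set (o ⊔ ℓ ⊔ m) where
      constructor span
      field
        dom : Obj
        d : dom ⇒ X
        d∈M : M d
        f : dom ⇒ Y

    open _⇀_

    infix 4 _≈ₚ_
    _≈ₚ_ : ∀ {X Y} → X ⇀ Y → X ⇀ Y → Set (ℓ ⊔ e)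
    p ≈ₚ q = Σ[ i ∈ dom p ⇒ dom q ] (IsIso i × (d q ∘ i ≈ d p × f q ∘ i ≈ f p))

    total : ∀ {X Y} → X ⇒ Y → X ⇀ Y
    total g = span _ id M-id g

    infixr 9 _∘ₚ_
    _∘ₚ_ : ∀ {X Y Z} → Y ⇀ Z → X ⇀ Y → X ⇀ Z
    q ∘ₚ p = span (pb-obj (d q) (d∈M q) (f p))
                  (d p ∘ pb₁ (d q) (d∈M q) (f p))
                  (M-∘ (d∈M p) (M-stable (d∈M q) (pb-isPullback (d q) (d∈M q) (f p))))
                  (f q ∘ pb₂ (d q) (d∈M q) (f p))

  -- Partial cartesian closed category: for each A, the functor
  -- C --(- × A)--> C ↪ P(C,M) has a right adjoint, given pointwise by
  -- universal arrows (cofree objects) for every object B.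
  module PCCC {m : Level} (Cart : Cartesian) (Dom : Dominion m) where
    open Cartesian Cart
    open Dominion Dom
    open Partial Dom

    record RightAdjointAt (A B : Obj) : Set (o ⊔ ℓ ⊔ e ⊔ m) where
      field
        R : Obj
        ε : (R ×ₒ A) ⇀ B
        universal : ∀ {X} (p : (X ×ₒ A) ⇀ B) →
          Σ[ g ∈ X ⇒ R ] ((ε ∘ₚ total (g ⁂ id) ≈ₚ p) ×
            (∀ (h : X ⇒ R) → ε ∘ₚ total (h ⁂ id) ≈ₚ p → h ≈ g))

    IsPartialCCC : Set (o ⊔ ℓ ⊔ e ⊔ m)
    IsPartialCCC = ∀ (A B : Obj) → RightAdjointAt A B

    WithEquality : Set (o ⊔ m)
    WithEquality = ∀ {A} → M (Δ {A})

  HasDisjointFiniteCoproducts : Set (o ⊔ ℓ ⊔ e)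
  HasDisjointFiniteCoproducts =
    Σ[ I ∈ Obj ] Σ[ I-init ∈ IsInitial I ]
      ((∀ (A B : Obj) → Σ[ S ∈ Obj ] Σ[ i₁ ∈ A ⇒ S ] Σ[ i₂ ∈ B ⇒ S ] IsCoproduct i₁ i₂) ×
       (∀ {A B S} (i₁ : A ⇒ S) (i₂ : B ⇒ S) → IsCoproduct i₁ i₂ →
          IsPullback (proj₁ (I-init A)) (proj₁ (I-init B)) i₁ i₂))

  RHS : Cartesian → Set (o ⊔ ℓ ⊔ e)
  RHS Cart =
    Σ[ I ∈ Obj ] Σ[ I-strict ∈ IsStrictInitial I ]
      ((Σ[ S ∈ Obj ] Σ[ i₁ ∈ ⊤ ⇒ S ] Σ[ i₂ ∈ ⊤ ⇒ S ] IsCoproduct i₁ i₂) ×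
       RegularMono (proj₁ (proj₁ I-strict ⊤)))
    where open Cartesian Cart

module Submission where

open import Defs
open import Level using (Level; _⊔_)
open import Function.Bundles using (_⇔_; mk⇔)
open import Data.Product using (Σ; _×_; _,_; proj₁; proj₂; Σ-syntax)
open import Relation.Binary using (IsEquivalence)

-- The right adjoint of (- × A) at B is used throughout as a classifier: maps
-- X → R correspond to partial maps X × A ⇀ B, the correspondence being
-- "pull back the counit ε".
--
-- (⇒) Maps out of 0 × A are classified by maps out of 0, hence unique; so
-- every X → 0 is invertible (StrictInitial).  Disjointness of 1 + 1 makes
-- 0 → 1 the equalizer of its injections.
-- (⇐) Every coproduct is disjoint, since a cone over its injections maps into
-- the equalizer 0 → 1 (Disjointness).  Being regular, 0 → 1 is in M, which
-- gives empty partial maps; with them A and B embed into a common ⊤ × X, and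
-- A + B is the subobject of (1 + 1) × X classified by the copairing of the
-- classifiers of the two embeddings (DomainClassifier, BinaryCoproducts).

module CategoryFacts {o ℓ e : Level} (C : Category o ℓ e) where
  open Category C
  open Notions C

  module ≈ {A B : Obj} = IsEquivalence (≈-equiv {A} {B})

  infix  1 begin_
  infixr 2 _≈⟨_⟩_
  infix  3 _∎

  begin_ : ∀ {A B} {f g : A ⇒ B} → f ≈ g → f ≈ g
  begin p = p

  _≈⟨_⟩_ : ∀ {A B} (f : A ⇒ B) {g h : A ⇒ B} → f ≈ g → g ≈ h → f ≈ h
  f ≈⟨ p ⟩ q = ≈.trans p q

  _∎ : ∀ {A B} (f : A ⇒ B) → f ≈ f
  f ∎ = ≈.refl

  ∘-resp-≈ˡ : ∀ {A B C} {f h : B ⇒ C} {g : A ⇒ B} → f ≈ h → f ∘ g ≈ h ∘ g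
  ∘-resp-≈ˡ p = ∘-resp-≈ p ≈.refl

  ∘-resp-≈ʳ : ∀ {A B C} {f : B ⇒ C} {g i : A ⇒ B} → g ≈ i → f ∘ g ≈ f ∘ i
  ∘-resp-≈ʳ p = ∘-resp-≈ ≈.refl p

  sym-assoc : ∀ {A B C D} {f : A ⇒ B} {g : B ⇒ C} {h : C ⇒ D} → h ∘ (g ∘ f) ≈ (h ∘ g) ∘ f
  sym-assoc = ≈.sym assoc

  extend-square : ∀ {A B C D Q} {f : B ⇒ D} {p : A ⇒ B} {g : C ⇒ D} {q : A ⇒ C} {x : Q ⇒ A} →
                  f ∘ p ≈ g ∘ q → f ∘ (p ∘ x) ≈ g ∘ (q ∘ x)
  extend-square sq = ≈.trans sym-assoc (≈.trans (∘-resp-≈ˡ sq) assoc)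

  module Pullback {P A B Z} {p₁ : P ⇒ A} {p₂ : P ⇒ B} {f : A ⇒ Z} {g : B ⇒ Z}
                  (pb : IsPullback p₁ p₂ f g) where
    commute : f ∘ p₁ ≈ g ∘ p₂
    commute = proj₁ pb

    module _ {Q} {q₁ : Q ⇒ A} {q₂ : Q ⇒ B} (eq : f ∘ q₁ ≈ g ∘ q₂) where
      universal : Q ⇒ P
      universal = proj₁ (proj₂ pb q₁ q₂ eq)

      p₁∘universal : p₁ ∘ universal ≈ q₁
      p₁∘universal = proj₁ (proj₁ (proj₂ (proj₂ pb q₁ q₂ eq)))

      p₂∘universal : p₂ ∘ universal ≈ q₂
      p₂∘universal = proj₂ (proj₁ (proj₂ (proj₂ pb q₁ q₂ eq)))

      unique : (v : Q ⇒ P) → p₁ ∘ v ≈ q₁ → p₂ ∘ v ≈ q₂ → v ≈ universal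
      unique = proj₂ (proj₂ (proj₂ pb q₁ q₂ eq))

    jointly-mono : ∀ {Q} {x y : Q ⇒ P} → p₁ ∘ x ≈ p₁ ∘ y → p₂ ∘ x ≈ p₂ ∘ y → x ≈ y
    jointly-mono {x = x} {y} e₁ e₂ =
      ≈.trans (unique sq x e₁ e₂) (≈.sym (unique sq y ≈.refl ≈.refl))
      where
      sq : f ∘ (p₁ ∘ y) ≈ g ∘ (p₂ ∘ y)
      sq = extend-square commute

  module Coproduct {S A B} {i₁ : A ⇒ S} {i₂ : B ⇒ S} (cop : IsCoproduct i₁ i₂) where
    [_,_] : ∀ {Q} → A ⇒ Q → B ⇒ Q → S ⇒ Q
    [ q₁ , q₂ ] = proj₁ (cop q₁ q₂)

    inject₁ : ∀ {Q} {q₁ : A ⇒ Q} {q₂ : B ⇒ Q} → [ q₁ , q₂ ] ∘ i₁ ≈ q₁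
    inject₁ {q₁ = q₁} {q₂} = proj₁ (proj₁ (proj₂ (cop q₁ q₂)))

    inject₂ : ∀ {Q} {q₁ : A ⇒ Q} {q₂ : B ⇒ Q} → [ q₁ , q₂ ] ∘ i₂ ≈ q₂
    inject₂ {q₁ = q₁} {q₂} = proj₂ (proj₁ (proj₂ (cop q₁ q₂)))

    jointly-epi : ∀ {Q} {u v : S ⇒ Q} → u ∘ i₁ ≈ v ∘ i₁ → u ∘ i₂ ≈ v ∘ i₂ → u ≈ v
    jointly-epi {u = u} {v} e₁ e₂ =
      ≈.trans (proj₂ (proj₂ (cop (v ∘ i₁) (v ∘ i₂))) u e₁ e₂)
              (≈.sym (proj₂ (proj₂ (cop (v ∘ i₁) (v ∘ i₂))) v ≈.refl ≈.refl))

  module Initial {I} (init : IsInitial I) where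
    ¡ : ∀ {X} → I ⇒ X
    ¡ {X} = proj₁ (init X)

    ¡-unique : ∀ {X} (x y : I ⇒ X) → x ≈ y
    ¡-unique {X} x y = ≈.trans (proj₂ (init X) x) (≈.sym (proj₂ (init X) y))

    unique-maps-out⇒iso : ∀ {X} (f : X ⇒ I) → (∀ {W} (x y : X ⇒ W) → x ≈ y) → IsIso f
    unique-maps-out⇒iso f unique-out = ¡ , unique-out _ _ , ¡-unique _ _

  strict⇒unique-maps-out : ∀ {I Q W} → IsStrictInitial I → (u : Q ⇒ I) → (x y : Q ⇒ W) → x ≈ y
  strict⇒unique-maps-out (init , strict) u x y with strict u
  ... | u⁻¹ , u⁻¹∘u , _ = begin
    x                 ≈⟨ ≈.sym identityʳ ⟩
    x ∘ id            ≈⟨ ∘-resp-≈ʳ (≈.sym u⁻¹∘u) ⟩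
    x ∘ (u⁻¹ ∘ u)     ≈⟨ sym-assoc ⟩
    (x ∘ u⁻¹) ∘ u     ≈⟨ ∘-resp-≈ˡ (Initial.¡-unique init _ _) ⟩
    (y ∘ u⁻¹) ∘ u     ≈⟨ assoc ⟩
    y ∘ (u⁻¹ ∘ u)     ≈⟨ ∘-resp-≈ʳ u⁻¹∘u ⟩
    y ∘ id            ≈⟨ identityʳ ⟩
    y                 ∎

  iso-transpose : ∀ {A B X} {i : A ⇒ B} {p : A ⇒ X} {q : B ⇒ X} (iso : IsIso i) →
                  q ∘ i ≈ p → q ≈ p ∘ proj₁ iso
  iso-transpose {i = i} {p} {q} (i⁻¹ , _ , i∘i⁻¹) q∘i≈p = begin
    q                 ≈⟨ ≈.sym identityʳ ⟩
    q ∘ id            ≈⟨ ∘-resp-≈ʳ (≈.sym i∘i⁻¹) ⟩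
    q ∘ (i ∘ i⁻¹)     ≈⟨ sym-assoc ⟩
    (q ∘ i) ∘ i⁻¹     ≈⟨ ∘-resp-≈ˡ q∘i≈p ⟩
    p ∘ i⁻¹           ∎

  module Equalizer {E A B} {m : E ⇒ A} {f g : A ⇒ B} (eqz : IsEqualizer m f g) where
    equalize : f ∘ m ≈ g ∘ m
    equalize = proj₁ eqz

    module _ {Q} {q : Q ⇒ A} (eq : f ∘ q ≈ g ∘ q) where
      universal : Q ⇒ E
      universal = proj₁ (proj₂ eqz q eq)

      m∘universal : m ∘ universal ≈ q
      m∘universal = proj₁ (proj₂ (proj₂ eqz q eq))

      unique : (v : Q ⇒ E) → m ∘ v ≈ q → v ≈ universal
      unique = proj₂ (proj₂ (proj₂ eqz q eq))

  diagonal-pullback⇒equalizer : ∀ {P A Z} {p : P ⇒ A} {f g : A ⇒ Z} →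
                                IsPullback p p f g → IsEqualizer p f g
  diagonal-pullback⇒equalizer pb =
    commute , λ q eq → universal eq , p₁∘universal eq , λ v e → unique eq v e e
    where open Pullback pb

  module _ {P A B Z} {p₁ : P ⇒ A} {p₂ : P ⇒ B} {f : A ⇒ Z} {g : B ⇒ Z}
           (pb : IsPullback p₁ p₂ f g) where
    open Pullback pb

    pullback-resp-legs : ∀ {p₁' p₂'} → p₁ ≈ p₁' → p₂ ≈ p₂' → IsPullback p₁' p₂' f g
    pullback-resp-legs e₁ e₂ =
      ≈.trans (∘-resp-≈ʳ (≈.sym e₁)) (≈.trans commute (∘-resp-≈ʳ e₂)) ,
      λ q₁ q₂ eq →
        universal eq ,
        (≈.trans (∘-resp-≈ˡ (≈.sym e₁)) (p₁∘universal eq) ,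
         ≈.trans (∘-resp-≈ˡ (≈.sym e₂)) (p₂∘universal eq)) ,
        λ v v₁ v₂ → unique eq v (≈.trans (∘-resp-≈ˡ e₁) v₁) (≈.trans (∘-resp-≈ˡ e₂) v₂)

    pullback-resp-cospan : ∀ {f'} → f ≈ f' → IsPullback p₁ p₂ f' g
    pullback-resp-cospan e =
      ≈.trans (∘-resp-≈ˡ (≈.sym e)) commute ,
      λ q₁ q₂ eq → proj₂ pb q₁ q₂ (≈.trans (∘-resp-≈ˡ e) eq)

    pullback-∘-iso : ∀ {P'} (j : P' ⇒ P) → IsIso j → IsPullback (p₁ ∘ j) (p₂ ∘ j) f g
    pullback-∘-iso j (j⁻¹ , j⁻¹∘j , j∘j⁻¹) =
      extend-square commute ,
      λ q₁ q₂ eq →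
        j⁻¹ ∘ universal eq ,
        (through-j (p₁∘universal eq) , through-j (p₂∘universal eq)) ,
        λ v v₁ v₂ → begin
          v                       ≈⟨ ≈.sym identityˡ ⟩
          id ∘ v                  ≈⟨ ∘-resp-≈ˡ (≈.sym j⁻¹∘j) ⟩
          (j⁻¹ ∘ j) ∘ v           ≈⟨ assoc ⟩
          j⁻¹ ∘ (j ∘ v)           ≈⟨ ∘-resp-≈ʳ (unique eq (j ∘ v) (≈.trans sym-assoc v₁)
                                                              (≈.trans sym-assoc v₂)) ⟩
          j⁻¹ ∘ universal eq      ∎
      where
      through-j : ∀ {Q X} {p : P ⇒ X} {u : Q ⇒ P} {q : Q ⇒ X} → p ∘ u ≈ q → (p ∘ j) ∘ (j⁻¹ ∘ u) ≈ q
      through-j {p = p} {u} {q} pu = begin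
        (p ∘ j) ∘ (j⁻¹ ∘ u)     ≈⟨ assoc ⟩
        p ∘ (j ∘ (j⁻¹ ∘ u))     ≈⟨ ∘-resp-≈ʳ sym-assoc ⟩
        p ∘ ((j ∘ j⁻¹) ∘ u)     ≈⟨ ∘-resp-≈ʳ (∘-resp-≈ˡ j∘j⁻¹) ⟩
        p ∘ (id ∘ u)            ≈⟨ ∘-resp-≈ʳ identityˡ ⟩
        p ∘ u                   ≈⟨ pu ⟩
        q                       ∎

  pullback-unique-up-to-iso :
    ∀ {P P' A B Z} {p₁ : P ⇒ A} {p₂ : P ⇒ B} {p₁' : P' ⇒ A} {p₂' : P' ⇒ B} {f : A ⇒ Z} {g : B ⇒ Z} →
    IsPullback p₁ p₂ f g → IsPullback p₁' p₂' f g →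
    Σ[ φ ∈ P ⇒ P' ] (IsIso φ × (p₁' ∘ φ ≈ p₁ × p₂' ∘ φ ≈ p₂))
  pullback-unique-up-to-iso {P} {P'} pb pb' =
    φ , (ψ , round-trip pb (PB'.p₁∘universal _) (PB'.p₂∘universal _)
                           (PB.p₁∘universal _) (PB.p₂∘universal _)
           , round-trip pb' (PB.p₁∘universal _) (PB.p₂∘universal _)
                            (PB'.p₁∘universal _) (PB'.p₂∘universal _)) ,
    (PB'.p₁∘universal _ , PB'.p₂∘universal _)
    where
    module PB = Pullback pb
    module PB' = Pullback pb'
    φ : P ⇒ P'
    φ = PB'.universal PB.commute
    ψ : P' ⇒ P
    ψ = PB.universal PB'.commute
    round-trip : ∀ {Q R A B Z} {r₁ : R ⇒ A} {r₂ : R ⇒ B} {s₁ : Q ⇒ A} {s₂ : Q ⇒ B}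
                   {f : A ⇒ Z} {g : B ⇒ Z} {α : R ⇒ Q} {β : Q ⇒ R} →
                 IsPullback r₁ r₂ f g →
                 s₁ ∘ α ≈ r₁ → s₂ ∘ α ≈ r₂ → r₁ ∘ β ≈ s₁ → r₂ ∘ β ≈ s₂ → β ∘ α ≈ id
    round-trip pbR sα₁ sα₂ rβ₁ rβ₂ =
      Pullback.jointly-mono pbR
        (≈.trans sym-assoc (≈.trans (∘-resp-≈ˡ rβ₁) (≈.trans sα₁ (≈.sym identityʳ))))
        (≈.trans sym-assoc (≈.trans (∘-resp-≈ˡ rβ₂) (≈.trans sα₂ (≈.sym identityʳ))))

  pullback-paste : ∀ {P A B Z Q A'} {p₁ : P ⇒ A} {p₂ : P ⇒ B} {f : A ⇒ Z} {g : B ⇒ Z}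
                     {q₁ : Q ⇒ A'} {q₂ : Q ⇒ P} {h : A' ⇒ A} →
                   IsPullback p₁ p₂ f g → IsPullback q₁ q₂ h p₁ → IsPullback q₁ (p₂ ∘ q₂) (f ∘ h) g
  pullback-paste {p₁ = p₁} {p₂} {f} {g} {q₁} {q₂} {h} pb₁ pb₂ =
    outer-square ,
    λ r₁ r₂ eq →
      let eq₁ = ≈.trans sym-assoc eq
          eq₂ = ≈.sym (P₁.p₁∘universal eq₁)
      in P₂.universal eq₂ ,
         (P₂.p₁∘universal eq₂ ,
          ≈.trans assoc (≈.trans (∘-resp-≈ʳ (P₂.p₂∘universal eq₂)) (P₁.p₂∘universal eq₁))) ,
         λ v v₁ v₂ →
           P₂.unique eq₂ v v₁
             (P₁.unique eq₁ (q₂ ∘ v)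
               (≈.trans sym-assoc (≈.trans (∘-resp-≈ˡ (≈.sym P₂.commute)) (≈.trans assoc (∘-resp-≈ʳ v₁))))
               (≈.trans sym-assoc v₂))
    where
    module P₁ = Pullback pb₁
    module P₂ = Pullback pb₂
    outer-square : (f ∘ h) ∘ q₁ ≈ g ∘ (p₂ ∘ q₂)
    outer-square = begin
      (f ∘ h) ∘ q₁    ≈⟨ assoc ⟩
      f ∘ (h ∘ q₁)    ≈⟨ ∘-resp-≈ʳ P₂.commute ⟩
      f ∘ (p₁ ∘ q₂)   ≈⟨ extend-square P₁.commute ⟩
      g ∘ (p₂ ∘ q₂)   ∎

  pullback-cancel : ∀ {P A B Z Q A'} {p₁ : P ⇒ A} {p₂ : P ⇒ B} {f : A ⇒ Z} {g : B ⇒ Z}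
                      {q₁ : Q ⇒ A'} {q₂ : Q ⇒ P} {h : A' ⇒ A} →
                    IsPullback p₁ p₂ f g → h ∘ q₁ ≈ p₁ ∘ q₂ →
                    IsPullback q₁ (p₂ ∘ q₂) (f ∘ h) g → IsPullback q₁ q₂ h p₁
  pullback-cancel {p₁ = p₁} {p₂} {f} {g} {q₁} {q₂} {h} pb₁ sq outer =
    sq ,
    λ r₁ r₂ eq →
      let outer-eq : (f ∘ h) ∘ r₁ ≈ g ∘ (p₂ ∘ r₂)
          outer-eq = ≈.trans assoc (≈.trans (∘-resp-≈ʳ eq) (extend-square P₁.commute))
          u = O.universal outer-eq
          q₂∘u : q₂ ∘ u ≈ r₂
          q₂∘u = P₁.jointly-mono
            (begin
              p₁ ∘ (q₂ ∘ u)   ≈⟨ sym-assoc ⟩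
              (p₁ ∘ q₂) ∘ u   ≈⟨ ∘-resp-≈ˡ (≈.sym sq) ⟩
              (h ∘ q₁) ∘ u    ≈⟨ assoc ⟩
              h ∘ (q₁ ∘ u)    ≈⟨ ∘-resp-≈ʳ (O.p₁∘universal outer-eq) ⟩
              h ∘ r₁          ≈⟨ eq ⟩
              p₁ ∘ r₂         ∎)
            (≈.trans sym-assoc (O.p₂∘universal outer-eq))
      in u , (O.p₁∘universal outer-eq , q₂∘u) ,
         λ v v₁ v₂ → O.unique outer-eq v v₁ (≈.trans assoc (∘-resp-≈ʳ v₂))
    where
    module P₁ = Pullback pb₁
    module O = Pullback outer

  pullback-of-mono-along-factor : ∀ {W D Z} {n : D ⇒ Z} {h : W ⇒ Z} {t : W ⇒ D} →
                                  Mono n → h ≈ n ∘ t → IsPullback id t h n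
  pullback-of-mono-along-factor {t = t} mono h≈nt =
    ≈.trans identityʳ h≈nt ,
    λ q₁ q₂ eq →
      q₁ ,
      (identityˡ , mono (t ∘ q₁) q₂ (≈.trans sym-assoc (≈.trans (∘-resp-≈ˡ (≈.sym h≈nt)) eq))) ,
      λ v v₁ _ → ≈.trans (≈.sym identityˡ) v₁

module CartesianFacts {o ℓ e : Level} (C : Category o ℓ e) (Cart : Notions.Cartesian C) where
  open Category C
  open Notions C
  open Cartesian Cart
  open CategoryFacts C

  π₁∘⟨⟩ : ∀ {Q A B} {f : Q ⇒ A} {g : Q ⇒ B} → π₁ ∘ ⟨ f , g ⟩ ≈ f
  π₁∘⟨⟩ {f = f} {g} = proj₁ (proj₁ (proj₂ (product f g)))

  π₂∘⟨⟩ : ∀ {Q A B} {f : Q ⇒ A} {g : Q ⇒ B} → π₂ ∘ ⟨ f , g ⟩ ≈ g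
  π₂∘⟨⟩ {f = f} {g} = proj₂ (proj₁ (proj₂ (product f g)))

  π₁∘⟨⟩∘ : ∀ {Q P A B} {f : P ⇒ A} {g : P ⇒ B} {h : Q ⇒ P} → π₁ ∘ (⟨ f , g ⟩ ∘ h) ≈ f ∘ h
  π₁∘⟨⟩∘ = ≈.trans sym-assoc (∘-resp-≈ˡ π₁∘⟨⟩)

  π₂∘⟨⟩∘ : ∀ {Q P A B} {f : P ⇒ A} {g : P ⇒ B} {h : Q ⇒ P} → π₂ ∘ (⟨ f , g ⟩ ∘ h) ≈ g ∘ h
  π₂∘⟨⟩∘ = ≈.trans sym-assoc (∘-resp-≈ˡ π₂∘⟨⟩)

  ⟨⟩-ext : ∀ {Q A B} {u v : Q ⇒ (A ×ₒ B)} → π₁ ∘ u ≈ π₁ ∘ v → π₂ ∘ u ≈ π₂ ∘ v → u ≈ v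
  ⟨⟩-ext {u = u} {v} e₁ e₂ =
    ≈.trans (proj₂ (proj₂ (product (π₁ ∘ v) (π₂ ∘ v))) u e₁ e₂)
            (≈.sym (proj₂ (proj₂ (product (π₁ ∘ v) (π₂ ∘ v))) v ≈.refl ≈.refl))

  ! : ∀ {X} → X ⇒ ⊤
  ! {X} = proj₁ (⊤-terminal X)

  !-unique : ∀ {X} (f g : X ⇒ ⊤) → f ≈ g
  !-unique {X} f g = ≈.trans (proj₂ (⊤-terminal X) f) (≈.sym (proj₂ (⊤-terminal X) g))

  π₁∘⁂∘ : ∀ {Q A B C D} {f : A ⇒ B} {g : C ⇒ D} {x : Q ⇒ (A ×ₒ C)} →
          π₁ ∘ ((f ⁂ g) ∘ x) ≈ f ∘ (π₁ ∘ x)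
  π₁∘⁂∘ = ≈.trans π₁∘⟨⟩∘ assoc

  π₂∘⁂∘ : ∀ {Q A B C D} {f : A ⇒ B} {g : C ⇒ D} {x : Q ⇒ (A ×ₒ C)} →
          π₂ ∘ ((f ⁂ g) ∘ x) ≈ g ∘ (π₂ ∘ x)
  π₂∘⁂∘ = ≈.trans π₂∘⟨⟩∘ assoc

  ⁂-cong : ∀ {A B C D} {f f' : A ⇒ B} {g g' : C ⇒ D} → f ≈ f' → g ≈ g' → f ⁂ g ≈ f' ⁂ g'
  ⁂-cong e₁ e₂ = ⟨⟩-ext (≈.trans π₁∘⟨⟩ (≈.trans (∘-resp-≈ˡ e₁) (≈.sym π₁∘⟨⟩)))
                        (≈.trans π₂∘⟨⟩ (≈.trans (∘-resp-≈ˡ e₂) (≈.sym π₂∘⟨⟩)))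

  ⁂-∘ : ∀ {A B C D E F} {f : B ⇒ C} {g : E ⇒ F} {h : A ⇒ B} {k : D ⇒ E} →
        (f ⁂ g) ∘ (h ⁂ k) ≈ (f ∘ h) ⁂ (g ∘ k)
  ⁂-∘ = ⟨⟩-ext (≈.trans π₁∘⁂∘ (≈.trans (∘-resp-≈ʳ π₁∘⟨⟩) (≈.trans sym-assoc (≈.sym π₁∘⟨⟩))))
               (≈.trans π₂∘⁂∘ (≈.trans (∘-resp-≈ʳ π₂∘⟨⟩) (≈.trans sym-assoc (≈.sym π₂∘⟨⟩))))

  ⁂id-∘ : ∀ {A B C Z} {f : B ⇒ C} {g : A ⇒ B} → (f ⁂ id {Z}) ∘ (g ⁂ id) ≈ (f ∘ g) ⁂ id
  ⁂id-∘ = ≈.trans ⁂-∘ (⁂-cong ≈.refl identityˡ)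

  π₁-iso : ∀ {Y} → IsIso (π₁ {Y} {⊤})
  π₁-iso = ⟨ id , ! ⟩ ,
           ⟨⟩-ext (≈.trans π₁∘⟨⟩∘ (≈.trans identityˡ (≈.sym identityʳ))) (!-unique _ _) ,
           π₁∘⟨⟩

  ⟨id,!⟩-iso : ∀ {Y} → IsIso (⟨ id {Y} , ! {Y} ⟩)
  ⟨id,!⟩-iso = π₁ , proj₂ (proj₂ π₁-iso) , proj₁ (proj₂ π₁-iso)

  swap : ∀ {A B} → (A ×ₒ B) ⇒ (B ×ₒ A)
  swap = ⟨ π₂ , π₁ ⟩

  swap-iso : ∀ {A B} → IsIso (swap {A} {B})
  swap-iso = swap , involutive , involutive
    where
    involutive : ∀ {A B} → swap {B} {A} ∘ swap {A} {B} ≈ id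
    involutive = ⟨⟩-ext (≈.trans π₁∘⟨⟩∘ (≈.trans π₂∘⟨⟩ (≈.sym identityʳ)))
                        (≈.trans π₂∘⟨⟩∘ (≈.trans π₁∘⟨⟩ (≈.sym identityʳ)))

module DominionFacts {o ℓ e m : Level} (C : Category o ℓ e) (Cart : Notions.Cartesian C)
                     (Dom : Notions.Dominion C m) where
  open Category C
  open Notions C
  open Cartesian Cart
  open Dominion Dom
  open CategoryFacts C
  open CartesianFacts C Cart

  M-resp-≈ : ∀ {A B} {f g : A ⇒ B} → M f → f ≈ g → M g
  M-resp-≈ {f = f} {g} Mf f≈g = M-stable Mf g-pulls-back-f
    where
    g-pulls-back-f : IsPullback g id id f
    g-pulls-back-f =
      ≈.trans identityˡ (≈.trans (≈.sym f≈g) (≈.sym identityʳ)) ,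
      λ q₁ q₂ eq →
        q₂ ,
        (≈.trans (∘-resp-≈ˡ (≈.sym f≈g)) (≈.trans (≈.sym eq) identityˡ) , identityˡ) ,
        λ v _ v₂ → ≈.trans (≈.sym identityˡ) v₂

  iso∈M : ∀ {A B} {j : A ⇒ B} → IsIso j → M j
  iso∈M {j = j} (j⁻¹ , j⁻¹∘j , j∘j⁻¹) = M-stable M-id j-pulls-back-id
    where
    j-pulls-back-id : IsPullback j j id id
    j-pulls-back-id =
      ≈.refl ,
      λ q₁ q₂ eq →
        let j∘j⁻¹∘ : ∀ {Q} {q : Q ⇒ _} → j ∘ (j⁻¹ ∘ q) ≈ q
            j∘j⁻¹∘ = ≈.trans sym-assoc (≈.trans (∘-resp-≈ˡ j∘j⁻¹) identityˡ)
        in j⁻¹ ∘ q₁ ,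
           (j∘j⁻¹∘ , ≈.trans j∘j⁻¹∘ (≈.trans (≈.sym identityˡ) (≈.trans eq identityˡ))) ,
           λ v v₁ _ → ≈.trans (≈.sym identityˡ)
                        (≈.trans (∘-resp-≈ˡ (≈.sym j⁻¹∘j)) (≈.trans assoc (∘-resp-≈ʳ v₁)))

  ⁂id∈M : ∀ {A B Z} {f : A ⇒ B} → M f → M (f ⁂ id {Z})
  ⁂id∈M {Z = Z} {f} Mf = M-stable Mf f⁂id-pulls-back-f
    where
    f⁂id-pulls-back-f : IsPullback (f ⁂ id {Z}) π₁ π₁ f
    f⁂id-pulls-back-f =
      π₁∘⟨⟩ ,
      λ q₁ q₂ eq →
        ⟨ q₂ , π₂ ∘ q₁ ⟩ ,
        (⟨⟩-ext (≈.trans π₁∘⁂∘ (≈.trans (∘-resp-≈ʳ π₁∘⟨⟩) (≈.sym eq)))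
                (≈.trans π₂∘⁂∘ (≈.trans identityˡ π₂∘⟨⟩)) ,
         π₁∘⟨⟩) ,
        λ v v₁ v₂ → proj₂ (proj₂ (product q₂ (π₂ ∘ q₁))) v v₂
                      (≈.trans (≈.sym identityˡ) (≈.trans (≈.sym π₂∘⁂∘) (∘-resp-≈ʳ v₁)))

  ⁂⊤∈M⇒∈M : ∀ {A B} {f : A ⇒ B} → M (f ⁂ id {⊤}) → M f
  ⁂⊤∈M⇒∈M Mf⁂id =
    M-resp-≈ (M-∘ (iso∈M π₁-iso) (M-∘ Mf⁂id (iso∈M ⟨id,!⟩-iso)))
             (≈.trans π₁∘⁂∘ (≈.trans (∘-resp-≈ʳ π₁∘⟨⟩) identityʳ))

  -- If I is strict initial and ¡ : I → ⊤ lies in M, then so does every ¡ : I → Y: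
  -- it is the pullback of ¡ : I → ⊤ along Y → ⊤.
  ¡∈M : ∀ {I} (strict : IsStrictInitial I) → M (Initial.¡ (proj₁ strict) {⊤}) →
        ∀ {Y} → M (Initial.¡ (proj₁ strict) {Y})
  ¡∈M strict M¡ {Y} = M-stable M¡ ¡-pulls-back-¡
    where
    open Initial (proj₁ strict)
    ¡-pulls-back-¡ : IsPullback ¡ id (! {Y}) ¡
    ¡-pulls-back-¡ =
      !-unique _ _ ,
      λ q₁ q₂ _ → q₂ , (strict⇒unique-maps-out strict q₂ _ _ , identityˡ) ,
                  λ _ _ v₂ → ≈.trans (≈.sym identityˡ) v₂

module EqualityFacts {o ℓ e m : Level} (C : Category o ℓ e) (Cart : Notions.Cartesian C)
                     (Dom : Notions.Dominion C m)
                     (Δ∈M : ∀ {A} → Notions.Dominion.M Dom (Notions.Cartesian.Δ Cart {A})) where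
  open Category C
  open Notions C
  open Cartesian Cart
  open Dominion Dom
  open CategoryFacts C
  open CartesianFacts C Cart
  open DominionFacts C Cart Dom

  Δ-factor : ∀ {Q A} {q : Q ⇒ (A ×ₒ A)} {t : Q ⇒ A} → q ≈ Δ ∘ t → π₁ ∘ q ≈ t × π₂ ∘ q ≈ t
  Δ-factor q≈Δt = ≈.trans (∘-resp-≈ʳ q≈Δt) (≈.trans π₁∘⟨⟩∘ identityˡ) ,
                  ≈.trans (∘-resp-≈ʳ q≈Δt) (≈.trans π₂∘⟨⟩∘ identityˡ)

  Δ-intro : ∀ {Q A} {q : Q ⇒ (A ×ₒ A)} {t : Q ⇒ A} → π₁ ∘ q ≈ t → π₂ ∘ q ≈ t → q ≈ Δ ∘ t
  Δ-intro e₁ e₂ = ⟨⟩-ext (≈.trans e₁ (≈.sym (≈.trans π₁∘⟨⟩∘ identityˡ)))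
                         (≈.trans e₂ (≈.sym (≈.trans π₂∘⟨⟩∘ identityˡ)))

  -- An equalizer of f and g is the pullback of Δ along ⟨ f , g ⟩.
  regular⇒M : ∀ {E A B} {m : E ⇒ A} {f g : A ⇒ B} → IsEqualizer m f g → M m
  regular⇒M {m = m} {f} {g} eqz = M-stable Δ∈M
    (Δ-intro π₁∘⟨⟩∘ (≈.trans π₂∘⟨⟩∘ (≈.sym equalize)) ,
     λ q₁ q₂ eq →
       let (fq₁ , gq₁) = Δ-factor {t = q₂} eq
           fq₁≈gq₁ = ≈.trans (≈.sym π₁∘⟨⟩∘) (≈.trans fq₁ (≈.sym (≈.trans (≈.sym π₂∘⟨⟩∘) gq₁)))
       in universal fq₁≈gq₁ ,
          (m∘universal fq₁≈gq₁ ,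
           ≈.trans assoc (≈.trans (∘-resp-≈ʳ (m∘universal fq₁≈gq₁))
                                  (≈.trans (≈.sym π₁∘⟨⟩∘) fq₁))) ,
          λ v v₁ _ → unique fq₁≈gq₁ v v₁)
    where open Equalizer eqz

  -- The graph ⟨ id , x ⟩ of x : A → W is the pullback of Δ along x × id.
  graph∈M : ∀ {A W} (x : A ⇒ W) → M ⟨ id , x ⟩
  graph∈M x = M-stable Δ∈M
    (Δ-intro (≈.trans π₁∘⁂∘ (≈.trans (∘-resp-≈ʳ π₁∘⟨⟩) identityʳ))
             (≈.trans π₂∘⁂∘ (≈.trans identityˡ π₂∘⟨⟩)) ,
     λ q₁ q₂ eq →
       let (xq₁ , q₁₂) = Δ-factor {t = q₂} eq
           xπ₁q₁ = ≈.trans (≈.sym π₁∘⁂∘) xq₁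
           π₂q₁ = ≈.trans (≈.sym identityˡ) (≈.trans (≈.sym π₂∘⁂∘) q₁₂)
       in π₁ ∘ q₁ ,
          (⟨⟩-ext (≈.trans π₁∘⟨⟩∘ identityˡ) (≈.trans π₂∘⟨⟩∘ (≈.trans xπ₁q₁ (≈.sym π₂q₁))) ,
           xπ₁q₁) ,
          λ v v₁ _ → ≈.trans (≈.sym identityˡ)
                       (≈.trans (∘-resp-≈ˡ (≈.sym π₁∘⟨⟩)) (≈.trans assoc (∘-resp-≈ʳ v₁))))

  -- ⟨ f , g ⟩ = (f × id) ∘ ⟨ id , g ⟩ lies in M when f does,
  pair∈M₁ : ∀ {Q A B} {f : Q ⇒ A} {g : Q ⇒ B} → M f → M ⟨ f , g ⟩
  pair∈M₁ Mf = M-resp-≈ (M-∘ (⁂id∈M Mf) (graph∈M _))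
    (⟨⟩-ext (≈.trans π₁∘⁂∘ (≈.trans (∘-resp-≈ʳ π₁∘⟨⟩) (≈.trans identityʳ (≈.sym π₁∘⟨⟩))))
            (≈.trans π₂∘⁂∘ (≈.trans identityˡ (≈.trans π₂∘⟨⟩ (≈.sym π₂∘⟨⟩)))))

  -- and ⟨ f , g ⟩ = swap ∘ ⟨ g , f ⟩ lies in M when g does.
  pair∈M₂ : ∀ {Q A B} {f : Q ⇒ A} {g : Q ⇒ B} → M g → M ⟨ f , g ⟩
  pair∈M₂ Mg = M-resp-≈ (M-∘ (iso∈M swap-iso) (pair∈M₁ Mg))
    (⟨⟩-ext (≈.trans π₁∘⟨⟩∘ (≈.trans π₂∘⟨⟩ (≈.sym π₁∘⟨⟩)))
            (≈.trans π₂∘⟨⟩∘ (≈.trans π₁∘⟨⟩ (≈.sym π₂∘⟨⟩))))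

-- The right adjoint of  C --(- × A)--> C ↪ P(C, M)  at B, read as a classifier:
-- g : X → R classifies the partial map p : X × A ⇀ B when p is, up to
-- isomorphism, the pullback of the counit ε along g × id.
module ClassifierFacts {o ℓ e m : Level} (C : Category o ℓ e) (Cart : Notions.Cartesian C)
                       (Dom : Notions.Dominion C m) {A B : Category.Obj C}
                       (adj : Notions.PCCC.RightAdjointAt C Cart Dom A B) where
  open Category C
  open Notions C
  open Cartesian Cart
  open Dominion Dom
  open Partial Dom
  open PCCC.RightAdjointAt adj public
  open CategoryFacts C
  open CartesianFacts C Cart
  open _⇀_ renaming (d to def; d∈M to def∈M; f to value)

  Dε : Obj
  Dε = dom ε

  dε : Dε ⇒ (R ×ₒ A)
  dε = def ε

  dε∈M : M dε
  dε∈M = def∈M ε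

  fε : Dε ⇒ B
  fε = value ε

  record Classifies {X} (g : X ⇒ R) (p : (X ×ₒ A) ⇀ B) : Set (o ⊔ ℓ ⊔ e) where
    constructor classifying
    field
      k : dom p ⇒ Dε
      square : IsPullback (def p) k (g ⁂ id) dε
      value-eq : fε ∘ k ≈ value p

  classifies-composite : ∀ {X} (g : X ⇒ R) → Classifies g (ε ∘ₚ total (g ⁂ id))
  classifies-composite g = classifying
    (pb₂ dε dε∈M (g ⁂ id))
    (pullback-resp-legs (pb-isPullback dε dε∈M (g ⁂ id)) (≈.sym identityˡ) ≈.refl)
    ≈.refl

  classifies-resp-≈ₚ : ∀ {X} {g : X ⇒ R} {p q : (X ×ₒ A) ⇀ B} → p ≈ₚ q → Classifies g p → Classifies g q
  classifies-resp-≈ₚ {p = p} {q} (i , i-iso , def-i , value-i) (classifying k pb fε∘k) = classifying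
    (k ∘ i⁻¹)
    (pullback-resp-legs (pullback-∘-iso pb i⁻¹ i⁻¹-iso) (≈.sym (iso-transpose i-iso def-i)) ≈.refl)
    (≈.sym (begin
      value q               ≈⟨ iso-transpose i-iso value-i ⟩
      value p ∘ i⁻¹         ≈⟨ ∘-resp-≈ˡ (≈.sym fε∘k) ⟩
      (fε ∘ k) ∘ i⁻¹        ≈⟨ assoc ⟩
      fε ∘ (k ∘ i⁻¹)        ∎))
    where
    i⁻¹ : dom q ⇒ dom p
    i⁻¹ = proj₁ i-iso
    i⁻¹-iso : IsIso i⁻¹
    i⁻¹-iso = i , proj₂ (proj₂ i-iso) , proj₁ (proj₂ i-iso)

  classifies⇒≈ₚ : ∀ {X} {g : X ⇒ R} {p : (X ×ₒ A) ⇀ B} → Classifies g p → ε ∘ₚ total (g ⁂ id) ≈ₚ p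
  classifies⇒≈ₚ {g = g} {p} (classifying k pb fε∘k) =
    φ , proj₁ (proj₂ comparison) , ≈.trans def∘φ (≈.sym identityˡ) ,
    ≈.trans (∘-resp-≈ˡ (≈.sym fε∘k)) (≈.trans assoc (∘-resp-≈ʳ k∘φ))
    where
    comparison : Σ[ φ ∈ dom (ε ∘ₚ total (g ⁂ id)) ⇒ dom p ]
                   (IsIso φ × (def p ∘ φ ≈ pb₁ dε dε∈M (g ⁂ id) × k ∘ φ ≈ pb₂ dε dε∈M (g ⁂ id)))
    comparison = pullback-unique-up-to-iso (pb-isPullback dε dε∈M (g ⁂ id)) pb
    φ : dom (ε ∘ₚ total (g ⁂ id)) ⇒ dom p
    φ = proj₁ comparison
    def∘φ : def p ∘ φ ≈ pb₁ dε dε∈M (g ⁂ id)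
    def∘φ = proj₁ (proj₂ (proj₂ comparison))
    k∘φ : k ∘ φ ≈ pb₂ dε dε∈M (g ⁂ id)
    k∘φ = proj₂ (proj₂ (proj₂ comparison))

  classifier : ∀ {X} (p : (X ×ₒ A) ⇀ B) → X ⇒ R
  classifier p = proj₁ (universal p)

  classifier-classifies : ∀ {X} (p : (X ×ₒ A) ⇀ B) → Classifies (classifier p) p
  classifier-classifies p =
    classifies-resp-≈ₚ (proj₁ (proj₂ (universal p))) (classifies-composite (classifier p))

  classifies-unique : ∀ {X} {g g' : X ⇒ R} {p : (X ×ₒ A) ⇀ B} →
                      Classifies g p → Classifies g' p → g ≈ g'
  classifies-unique {g = g} {g'} {p} cl cl' =
    ≈.trans (proj₂ (proj₂ (universal p)) g (classifies⇒≈ₚ cl))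
            (≈.sym (proj₂ (proj₂ (universal p)) g' (classifies⇒≈ₚ cl')))

  -- Classifiers of a fixed domain determine the value of the partial map,
  -- because the counit's domain inclusion dε is monic.
  classified-value-unique : ∀ {X D} {g g' : X ⇒ R} {n : D ⇒ (X ×ₒ A)} {Mn : M n} {v v' : D ⇒ B} →
                            g ≈ g' → Classifies g (span D n Mn v) → Classifies g' (span D n Mn v') → v ≈ v'
  classified-value-unique g≈g' (classifying k pb fε∘k) (classifying k' pb' fε∘k') =
    ≈.trans (≈.sym fε∘k) (≈.trans (∘-resp-≈ʳ k≈k') fε∘k')
    where
    k≈k' : k ≈ k'
    k≈k' = M-mono dε∈M k k'
      (≈.trans (≈.sym (proj₁ pb)) (≈.trans (∘-resp-≈ˡ (⁂-cong g≈g' ≈.refl)) (proj₁ pb')))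

  classifies-resp-map : ∀ {X} {g g' : X ⇒ R} {p : (X ×ₒ A) ⇀ B} → g ≈ g' → Classifies g p → Classifies g' p
  classifies-resp-map g≈g' (classifying k pb fε∘k) =
    classifying k (pullback-resp-cospan pb (⁂-cong g≈g' ≈.refl)) fε∘k

  classifies-resp-value : ∀ {X D} {g : X ⇒ R} {n : D ⇒ (X ×ₒ A)} {Mn : M n} {v v' : D ⇒ B} →
                          v ≈ v' → Classifies g (span D n Mn v) → Classifies g (span D n Mn v')
  classifies-resp-value v≈v' (classifying k pb fε∘k) = classifying k pb (≈.trans fε∘k v≈v')

  classifies-total : ∀ {X} {g : X ⇒ R} {v : (X ×ₒ A) ⇒ B} (k : (X ×ₒ A) ⇒ Dε) →
                     g ⁂ id ≈ dε ∘ k → fε ∘ k ≈ v → Classifies g (total v)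
  classifies-total k factor fε∘k =
    classifying k (pullback-of-mono-along-factor (M-mono dε∈M) factor) fε∘k

  classifies-reindex : ∀ {X Y D D'} {g : X ⇒ R} {h : Y ⇒ X} {n : D ⇒ (X ×ₒ A)} {Mn : M n}
                         {v : D ⇒ B} {n' : D' ⇒ (Y ×ₒ A)} {Mn' : M n'} {j : D' ⇒ D} →
                       Classifies g (span D n Mn v) → IsPullback n' j (h ⁂ id) n →
                       Classifies (g ∘ h) (span D' n' Mn' (v ∘ j))
  classifies-reindex (classifying k pb fε∘k) pb' = classifying
    _ (pullback-resp-cospan (pullback-paste pb pb') ⁂id-∘) (≈.trans sym-assoc (∘-resp-≈ˡ fε∘k))

  restrict-classified : ∀ {X Y D} {g : X ⇒ R} {h : Y ⇒ X} {g' : Y ⇒ R}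
                          {n : D ⇒ (X ×ₒ A)} {Mn : M n} {v : D ⇒ B} {p : (Y ×ₒ A) ⇀ B} →
                        Classifies g (span D n Mn v) → Classifies g' p → g ∘ h ≈ g' →
                        Σ[ j ∈ dom p ⇒ D ] IsPullback (def p) j (h ⁂ id) n
  restrict-classified {g = g} {h} {g'} {p = p} (classifying k pb _) (classifying k' pb' _) g∘h≈g' =
    j , pullback-cancel pb (≈.sym (Pullback.p₁∘universal pb square))
          (pullback-resp-legs (pullback-resp-cospan pb' (≈.sym g∘h⁂id)) ≈.refl
                              (≈.sym (Pullback.p₂∘universal pb square)))
    where
    g∘h⁂id : (g ⁂ id) ∘ (h ⁂ id) ≈ g' ⁂ id
    g∘h⁂id = ≈.trans ⁂id-∘ (⁂-cong g∘h≈g' ≈.refl)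
    square : (g ⁂ id) ∘ ((h ⁂ id) ∘ def p) ≈ dε ∘ k'
    square = ≈.trans sym-assoc (≈.trans (∘-resp-≈ˡ g∘h⁂id) (proj₁ pb'))
    j : dom p ⇒ _
    j = Pullback.universal pb square

module PartialMapClassifier {o ℓ e m : Level} (C : Category o ℓ e) (Cart : Notions.Cartesian C)
                            (Dom : Notions.Dominion C m) {A : Category.Obj C}
                            (adj : Notions.PCCC.RightAdjointAt C Cart Dom (Notions.Cartesian.⊤ Cart) A) where
  open Category C
  open Notions C
  open Cartesian Cart
  open Dominion Dom
  open Partial Dom
  open CategoryFacts C
  open CartesianFacts C Cart
  open DominionFacts C Cart Dom
  open ClassifierFacts C Cart Dom adj

  η : A ⇒ R
  η = classifier (total π₁)

  open Classifies (classifier-classifies (total π₁)) using (k) renaming (value-eq to fε∘k)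

  η⁂id≈dε∘k : η ⁂ id ≈ dε ∘ k
  η⁂id≈dε∘k = ≈.trans (≈.sym identityʳ) (proj₁ (Classifies.square (classifier-classifies (total π₁))))

  -- Naturality of the unit: η ∘ fε = π₁ ∘ dε, as both classify the total map
  -- fε ∘ π₁ : Dε × ⊤ → A.
  η∘fε : η ∘ fε ≈ π₁ ∘ dε
  η∘fε = classifies-unique
    (classifies-total (k ∘ (fε ⁂ id))
      (begin
        (η ∘ fε) ⁂ id            ≈⟨ ≈.sym ⁂id-∘ ⟩
        (η ⁂ id) ∘ (fε ⁂ id)     ≈⟨ ∘-resp-≈ˡ η⁂id≈dε∘k ⟩
        (dε ∘ k) ∘ (fε ⁂ id)     ≈⟨ assoc ⟩
        dε ∘ (k ∘ (fε ⁂ id))     ∎)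
      (≈.trans sym-assoc (≈.trans (∘-resp-≈ˡ fε∘k) π₁∘⟨⟩)))
    (classifies-total π₁ (⟨⟩-ext (≈.trans π₁∘⟨⟩ assoc) (!-unique _ _)) ≈.refl)

  -- Hence k is invertible, with inverse ⟨ fε , ! ⟩ (the second identity
  -- is checked after composing with the mono dε),
  k-iso : IsIso k
  k-iso = ⟨ fε , ! ⟩ ,
          ⟨⟩-ext (≈.trans π₁∘⟨⟩∘ (≈.trans fε∘k (≈.sym identityʳ))) (!-unique _ _) ,
          M-mono dε∈M _ _ (begin
            dε ∘ (k ∘ ⟨ fε , ! ⟩)    ≈⟨ sym-assoc ⟩
            (dε ∘ k) ∘ ⟨ fε , ! ⟩    ≈⟨ ∘-resp-≈ˡ (≈.sym η⁂id≈dε∘k) ⟩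
            (η ⁂ id) ∘ ⟨ fε , ! ⟩    ≈⟨ ⟨⟩-ext (≈.trans π₁∘⁂∘ (≈.trans (∘-resp-≈ʳ π₁∘⟨⟩) η∘fε))
                                              (!-unique _ _) ⟩
            dε                       ≈⟨ ≈.sym identityʳ ⟩
            dε ∘ id                  ∎)

  -- so η × id ≅ dε lies in M, and therefore so does η.
  η∈M : M η
  η∈M = ⁂⊤∈M⇒∈M (M-resp-≈ (M-∘ dε∈M (iso∈M k-iso)) (≈.sym η⁂id≈dε∘k))

-- Comparing the classifier R_Y of partial maps - × X ⇀ Y with the classifier
-- R_Ω of partial maps - × X ⇀ ⊤ (i.e. of M-subobjects): the map δ : R_Y → R_Ω
-- classifying the domain of the counit sends the classifier of a partial map
-- to the classifier of its domain, and every subobject classified through δ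
-- is the domain of a partial map.
module DomainClassifier {o ℓ e m : Level} (C : Category o ℓ e) (Cart : Notions.Cartesian C)
                        (Dom : Notions.Dominion C m) {X Y : Category.Obj C}
                        (adjY : Notions.PCCC.RightAdjointAt C Cart Dom X Y)
                        (adjΩ : Notions.PCCC.RightAdjointAt C Cart Dom X (Notions.Cartesian.⊤ Cart)) where
  open Category C
  open Notions C
  open Cartesian Cart
  open Dominion Dom
  open Partial Dom
  open CategoryFacts C
  open CartesianFacts C Cart
  open _⇀_ renaming (d to def; d∈M to def∈M; f to value)
  module RY = ClassifierFacts C Cart Dom adjY
  module RΩ = ClassifierFacts C Cart Dom adjΩ

  δ : RY.R ⇒ RΩ.R
  δ = RΩ.classifier (span RY.Dε RY.dε RY.dε∈M !)

  δ-classifies : RΩ.Classifies δ (span RY.Dε RY.dε RY.dε∈M !)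
  δ-classifies = RΩ.classifier-classifies (span RY.Dε RY.dε RY.dε∈M !)

  δ∘classifier : ∀ {W} {d : W ⇒ RY.R} {p : (W ×ₒ X) ⇀ Y} →
                 RY.Classifies d p → RΩ.Classifies (δ ∘ d) (span (dom p) (def p) (def∈M p) !)
  δ∘classifier (RY.classifying _ pb _) =
    RΩ.classifies-resp-value (!-unique _ _) (RΩ.classifies-reindex δ-classifies pb)

  -- If δ ∘ d classifies the subobject n, then n is the domain of a partial map
  -- classified by d: both are pullbacks of the same cospan.
  classified-by-δ∘ : ∀ {W E} {d : W ⇒ RY.R} {n : E ⇒ (W ×ₒ X)} {Mn : M n} {v : E ⇒ ⊤} →
                     RΩ.Classifies (δ ∘ d) (span E n Mn v) → Σ[ h ∈ E ⇒ Y ] RY.Classifies d (span E n Mn h)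
  classified-by-δ∘ {W} {E} {d} {n} (RΩ.classifying kE pbE _) =
    RY.fε ∘ (k' ∘ φ) ,
    RY.classifying (k' ∘ φ) (pullback-resp-legs (pullback-∘-iso pb' φ (proj₁ (proj₂ comparison))) def∘φ≈n ≈.refl)
                   ≈.refl
    where
    canonical : (W ×ₒ X) ⇀ Y
    canonical = RY.ε ∘ₚ total (d ⁂ id)

    k' : dom canonical ⇒ RY.Dε
    k' = RY.Classifies.k (RY.classifies-composite d)

    pb' : IsPullback (def canonical) k' (d ⁂ id) RY.dε
    pb' = RY.Classifies.square (RY.classifies-composite d)

    pasted : IsPullback (def canonical) (RΩ.Classifies.k δ-classifies ∘ k') ((δ ∘ d) ⁂ id) RΩ.dε
    pasted = pullback-resp-cospan (pullback-paste (RΩ.Classifies.square δ-classifies) pb') ⁂id-∘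

    comparison : Σ[ φ ∈ E ⇒ dom canonical ]
                   (IsIso φ × (def canonical ∘ φ ≈ n × (RΩ.Classifies.k δ-classifies ∘ k') ∘ φ ≈ kE))
    comparison = pullback-unique-up-to-iso pbE pasted

    φ : E ⇒ dom canonical
    φ = proj₁ comparison

    def∘φ≈n : def canonical ∘ φ ≈ n
    def∘φ≈n = proj₁ (proj₂ (proj₂ comparison))

module StrictInitial {o ℓ e m : Level} (C : Category o ℓ e) (Cart : Notions.Cartesian C)
                     (Dom : Notions.Dominion C m) (pccc : Notions.PCCC.IsPartialCCC C Cart Dom)
                     {I : Category.Obj C} (init : Notions.IsInitial C I) where
  open Category C
  open Notions C
  open Cartesian Cart
  open Partial Dom
  open CategoryFacts C
  open CartesianFacts C Cart
  open Initial init

  -- Any two maps I × A → B coincide: they are total maps classified by maps out of I.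
  maps-out-of-I×-unique : ∀ {A B} (g h : (I ×ₒ A) ⇒ B) → g ≈ h
  maps-out-of-I×-unique {A} {B} g h =
    classified-value-unique (¡-unique _ _) (classifier-classifies (total g)) (classifier-classifies (total h))
    where open ClassifierFacts C Cart Dom (pccc A B)

  -- A map f : W → I makes W a retract of I × W, so W has unique maps out.
  initial-strict : IsStrictInitial I
  initial-strict = init , λ f → unique-maps-out⇒iso f (through-I× f)
    where
    through-I× : ∀ {W Z} (f : W ⇒ I) (x y : W ⇒ Z) → x ≈ y
    through-I× f x y = begin
      x                            ≈⟨ ≈.sym identityʳ ⟩
      x ∘ id                       ≈⟨ ∘-resp-≈ʳ (≈.sym π₂∘⟨⟩) ⟩
      x ∘ (π₂ ∘ ⟨ f , id ⟩)        ≈⟨ sym-assoc ⟩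
      (x ∘ π₂) ∘ ⟨ f , id ⟩        ≈⟨ ∘-resp-≈ˡ (maps-out-of-I×-unique _ _) ⟩
      (y ∘ π₂) ∘ ⟨ f , id ⟩        ≈⟨ assoc ⟩
      y ∘ (π₂ ∘ ⟨ f , id ⟩)        ≈⟨ ∘-resp-≈ʳ π₂∘⟨⟩ ⟩
      y ∘ id                       ≈⟨ identityʳ ⟩
      y                            ∎

-- If I is strict initial and ¡ : I → ⊤ is an equalizer of two points
-- f, g : ⊤ → Z, then every binary coproduct is disjoint: a cone over the two
-- injections is sent by [ f ∘ ! , g ∘ ! ] into the equalizer of f and g, hence
-- its vertex maps into I.
module Disjointness {o ℓ e : Level} (C : Category o ℓ e) (Cart : Notions.Cartesian C)
                    {I : Category.Obj C} (strict : Notions.IsStrictInitial C I) where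
  open Category C
  open Notions C
  open Cartesian Cart
  open CategoryFacts C
  open CartesianFacts C Cart
  open Initial (proj₁ strict)

  coproducts-disjoint : ∀ {Z} {f g : ⊤ ⇒ Z} → IsEqualizer (¡ {⊤}) f g →
                        ∀ {A B S} (j₁ : A ⇒ S) (j₂ : B ⇒ S) → IsCoproduct j₁ j₂ → IsPullback ¡ ¡ j₁ j₂
  coproducts-disjoint {f = f} {g} eqz j₁ j₂ cop =
    ¡-unique _ _ ,
    λ q₁ q₂ eq →
      let u = Equalizer.universal eqz (f∘!≈g∘! eq)
      in u , (strict⇒unique-maps-out strict u _ _ , strict⇒unique-maps-out strict u _ _) ,
         λ _ _ _ → strict⇒unique-maps-out strict u _ _
    where
    open Coproduct cop
    f∘!≈g∘! : ∀ {Q} {q₁ : Q ⇒ _} {q₂ : Q ⇒ _} → j₁ ∘ q₁ ≈ j₂ ∘ q₂ → f ∘ ! ≈ g ∘ !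
    f∘!≈g∘! {q₁ = q₁} {q₂} eq = begin
      f ∘ !                                 ≈⟨ ∘-resp-≈ʳ (!-unique _ _) ⟩
      f ∘ (! ∘ q₁)                          ≈⟨ sym-assoc ⟩
      (f ∘ !) ∘ q₁                          ≈⟨ ∘-resp-≈ˡ (≈.sym inject₁) ⟩
      ([ f ∘ ! , g ∘ ! ] ∘ j₁) ∘ q₁         ≈⟨ assoc ⟩
      [ f ∘ ! , g ∘ ! ] ∘ (j₁ ∘ q₁)         ≈⟨ ∘-resp-≈ʳ eq ⟩
      [ f ∘ ! , g ∘ ! ] ∘ (j₂ ∘ q₂)         ≈⟨ sym-assoc ⟩
      ([ f ∘ ! , g ∘ ! ] ∘ j₂) ∘ q₂         ≈⟨ ∘-resp-≈ˡ inject₂ ⟩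
      (g ∘ !) ∘ q₂                          ≈⟨ assoc ⟩
      g ∘ (! ∘ q₂)                          ≈⟨ ∘-resp-≈ʳ (!-unique _ _) ⟩
      g ∘ !                                 ∎

-- Construction of A + B from S = 1 + 1.  A and B embed as M-subobjects ιA, ιB
-- of ⊤ × X, where X = R_A × R_B is the product of their partial map
-- classifiers.  With R_Ω the classifier of M-subobjects of - × X, ιA and ιB are
-- classified by points cA, cB : ⊤ → R_Ω; the subobject ιE : E ↣ S × X
-- classified by c = [ cA , cB ] is the coproduct, its injections being the
-- restrictions of ιE along i₁ × id and i₂ × id.
module BinaryCoproducts
    {o ℓ e m : Level} (C : Category o ℓ e) (Cart : Notions.Cartesian C)
    (Dom : Notions.Dominion C m) (pccc : Notions.PCCC.IsPartialCCC C Cart Dom)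
    (Δ∈M : ∀ {A} → Notions.Dominion.M Dom (Notions.Cartesian.Δ Cart {A}))
    {I : Category.Obj C} (strict : Notions.IsStrictInitial C I)
    (¡⊤∈M : Notions.Dominion.M Dom (CategoryFacts.Initial.¡ C (proj₁ strict) {Notions.Cartesian.⊤ Cart}))
    {S : Category.Obj C} {i₁ i₂ : Category._⇒_ C (Notions.Cartesian.⊤ Cart) S}
    (cop : Notions.IsCoproduct C i₁ i₂) (A B : Category.Obj C) where
  open Category C
  open Notions C
  open Cartesian Cart
  open Dominion Dom
  open Partial Dom
  open CategoryFacts C
  open CartesianFacts C Cart
  open DominionFacts C Cart Dom
  open EqualityFacts C Cart Dom Δ∈M
  open Coproduct cop
  open _⇀_ renaming (d to def; d∈M to def∈M; f to value)
  module RA = ClassifierFacts C Cart Dom (pccc ⊤ A)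
  module RB = ClassifierFacts C Cart Dom (pccc ⊤ B)

  -- The nowhere defined partial map, used to get some map A → R_B and B → R_A.
  empty : ∀ {W Z} → (W ×ₒ ⊤) ⇀ Z
  empty = span I ¡ (¡∈M strict ¡⊤∈M) ¡
    where open Initial (proj₁ strict)

  X : Obj
  X = RA.R ×ₒ RB.R

  -- The embeddings of A and B into ⊤ × X lie in M, because the units of the
  -- partial map classifiers do.
  ιA : A ⇒ (⊤ ×ₒ X)
  ιA = ⟨ ! , ⟨ PartialMapClassifier.η C Cart Dom (pccc ⊤ A) , RB.classifier empty ⟩ ⟩

  ιA∈M : M ιA
  ιA∈M = pair∈M₂ (pair∈M₁ (PartialMapClassifier.η∈M C Cart Dom (pccc ⊤ A)))

  ιB : B ⇒ (⊤ ×ₒ X)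
  ιB = ⟨ ! , ⟨ RA.classifier empty , PartialMapClassifier.η C Cart Dom (pccc ⊤ B) ⟩ ⟩

  ιB∈M : M ιB
  ιB∈M = pair∈M₂ (pair∈M₂ (PartialMapClassifier.η∈M C Cart Dom (pccc ⊤ B)))

  module RΩ = ClassifierFacts C Cart Dom (pccc X ⊤)

  cA : ⊤ ⇒ RΩ.R
  cA = RΩ.classifier (span A ιA ιA∈M !)

  cA-classifies : RΩ.Classifies cA (span A ιA ιA∈M !)
  cA-classifies = RΩ.classifier-classifies (span A ιA ιA∈M !)

  cB : ⊤ ⇒ RΩ.R
  cB = RΩ.classifier (span B ιB ιB∈M !)

  cB-classifies : RΩ.Classifies cB (span B ιB ιB∈M !)
  cB-classifies = RΩ.classifier-classifies (span B ιB ιB∈M !)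

  c : S ⇒ RΩ.R
  c = [ cA , cB ]

  Ê : (S ×ₒ X) ⇀ ⊤
  Ê = RΩ.ε ∘ₚ total (c ⁂ id)

  E : Obj
  E = dom Ê

  ιE : E ⇒ (S ×ₒ X)
  ιE = def Ê

  ιE∈M : M ιE
  ιE∈M = def∈M Ê

  inl-square : Σ[ inl ∈ A ⇒ E ] IsPullback ιA inl (i₁ ⁂ id) ιE
  inl-square = RΩ.restrict-classified (RΩ.classifies-composite c) cA-classifies inject₁

  inr-square : Σ[ inr ∈ B ⇒ E ] IsPullback ιB inr (i₂ ⁂ id) ιE
  inr-square = RΩ.restrict-classified (RΩ.classifies-composite c) cB-classifies inject₂

  inl : A ⇒ E
  inl = proj₁ inl-square

  inr : B ⇒ E
  inr = proj₁ inr-square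

  module _ {Y : Obj} where
    module RY = ClassifierFacts C Cart Dom (pccc X Y)

    agree-at : ∀ {D} {n : D ⇒ (⊤ ×ₒ X)} {Mn : M n} {j : D ⇒ E} {i : ⊤ ⇒ S} {v v' : E ⇒ Y}
                 {r r' : S ⇒ RY.R} →
               IsPullback n j (i ⁂ id) ιE → v ∘ j ≈ v' ∘ j →
               RY.Classifies r (span E ιE ιE∈M v) → RY.Classifies r' (span E ιE ιE∈M v') → r ∘ i ≈ r' ∘ i
    agree-at {Mn = Mn} pb vj≈v'j cl cl' =
      RY.classifies-unique (RY.classifies-reindex {Mn' = Mn} cl pb)
        (RY.classifies-resp-value (≈.sym vj≈v'j) (RY.classifies-reindex {Mn' = Mn} cl' pb))

    -- The injections are jointly epic: maps out of E are determined by their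
    -- classifiers S → R_Y, which are determined on i₁ and i₂.
    injections-jointly-epi : ∀ {v v' : E ⇒ Y} → v ∘ inl ≈ v' ∘ inl → v ∘ inr ≈ v' ∘ inr → v ≈ v'
    injections-jointly-epi {v} {v'} on-inl on-inr =
      RY.classified-value-unique
        (jointly-epi (agree-at {Mn = ιA∈M} (proj₂ inl-square) on-inl cl cl')
                     (agree-at {Mn = ιB∈M} (proj₂ inr-square) on-inr cl cl'))
        cl cl'
      where
      cl : RY.Classifies (RY.classifier (span E ιE ιE∈M v)) (span E ιE ιE∈M v)
      cl = RY.classifier-classifies (span E ιE ιE∈M v)
      cl' : RY.Classifies (RY.classifier (span E ιE ιE∈M v')) (span E ιE ιE∈M v')
      cl' = RY.classifier-classifies (span E ιE ιE∈M v')

    -- Copairing f₁ and f₂: the classifiers d₁, d₂ : ⊤ → R_Y of (ιA, f₁) and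
    -- (ιB, f₂) copair to d : S → R_Y; as δ ∘ d = c, the partial map
    -- classified by d is defined exactly on E, and its value is the copairing.
    module Copairing (f₁ : A ⇒ Y) (f₂ : B ⇒ Y) where
      open DomainClassifier C Cart Dom (pccc X Y) (pccc X ⊤) using (δ; δ∘classifier; classified-by-δ∘)

      d₁ : ⊤ ⇒ RY.R
      d₁ = RY.classifier (span A ιA ιA∈M f₁)

      d₂ : ⊤ ⇒ RY.R
      d₂ = RY.classifier (span B ιB ιB∈M f₂)

      d : S ⇒ RY.R
      d = [ d₁ , d₂ ]

      δ∘d-at : ∀ {D} {n : D ⇒ (⊤ ×ₒ X)} {Mn : M n} {f₀ : D ⇒ Y} {i : ⊤ ⇒ S} {d₀ : ⊤ ⇒ RY.R} {c₀ : ⊤ ⇒ RΩ.R} →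
               d ∘ i ≈ d₀ → c ∘ i ≈ c₀ → RY.Classifies d₀ (span D n Mn f₀) →
               RΩ.Classifies c₀ (span D n Mn !) → (δ ∘ d) ∘ i ≈ c ∘ i
      δ∘d-at {d₀ = d₀} {c₀} d∘i c∘i cl-d₀ cl-c₀ = begin
        (δ ∘ d) ∘ _    ≈⟨ assoc ⟩
        δ ∘ (d ∘ _)    ≈⟨ ∘-resp-≈ʳ d∘i ⟩
        δ ∘ d₀         ≈⟨ RΩ.classifies-unique (δ∘classifier cl-d₀) cl-c₀ ⟩
        c₀             ≈⟨ ≈.sym c∘i ⟩
        c ∘ _          ∎

      δ∘d≈c : δ ∘ d ≈ c
      δ∘d≈c = jointly-epi (δ∘d-at inject₁ inject₁ (RY.classifier-classifies _) cA-classifies)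
                          (δ∘d-at inject₂ inject₂ (RY.classifier-classifies _) cB-classifies)

      copair-classified : Σ[ h ∈ E ⇒ Y ] RY.Classifies d (span E ιE ιE∈M h)
      copair-classified = classified-by-δ∘ (RΩ.classifies-resp-map (≈.sym δ∘d≈c) (RΩ.classifies-composite c))

      copair : E ⇒ Y
      copair = proj₁ copair-classified

      copair∘inl : copair ∘ inl ≈ f₁
      copair∘inl = RY.classified-value-unique inject₁
        (RY.classifies-reindex (proj₂ copair-classified) (proj₂ inl-square)) (RY.classifier-classifies _)

      copair∘inr : copair ∘ inr ≈ f₂
      copair∘inr = RY.classified-value-unique inject₂
        (RY.classifies-reindex (proj₂ copair-classified) (proj₂ inr-square)) (RY.classifier-classifies _)

  E-coproduct : IsCoproduct inl inr
  E-coproduct f₁ f₂ =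
    copair , (copair∘inl , copair∘inr) ,
    λ v v∘inl v∘inr → injections-jointly-epi (≈.trans v∘inl (≈.sym copair∘inl))
                                             (≈.trans v∘inr (≈.sym copair∘inr))
    where open Copairing f₁ f₂

proposition5p2 : {o ℓ e m : Level} (C : Category o ℓ e) → let open Notions C in
    (Cart : Cartesian) (Dom : Dominion m) →
    PCCC.IsPartialCCC Cart Dom → PCCC.WithEquality Cart Dom →
    (HasDisjointFiniteCoproducts ⇔ RHS Cart)
proposition5p2 C Cart Dom pccc Δ∈M = mk⇔ disjoint⇒rhs rhs⇒disjoint
  where
  open Notions C
  open Cartesian Cart
  open CategoryFacts C

  -- The initial object is strict in any partial CCC, and since 1 + 1 is
  -- disjoint, 0 → 1 is the equalizer of its two injections.
  disjoint⇒rhs : HasDisjointFiniteCoproducts → RHS Cart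
  disjoint⇒rhs (I , init , coproducts , disjoint) with coproducts ⊤ ⊤
  ... | S , i₁ , i₂ , cop =
    I , StrictInitial.initial-strict C Cart Dom pccc init , (S , i₁ , i₂ , cop) ,
    (S , i₁ , i₂ , diagonal-pullback⇒equalizer (disjoint i₁ i₂ cop))

  -- A regular 0 → 1 makes every coproduct disjoint; it also lies in M, which
  -- lets A + B be built from 1 + 1 for all A and B.
  rhs⇒disjoint : RHS Cart → HasDisjointFiniteCoproducts
  rhs⇒disjoint (I , strict , (_ , _ , _ , cop) , (_ , _ , _ , eqz)) =
    I , proj₁ strict ,
    (λ A B → let open BinaryCoproducts C Cart Dom pccc Δ∈M strict ¡⊤∈M cop A B
             in E , inl , inr , E-coproduct) ,
    Disjointness.coproducts-disjoint C Cart strict eqz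
    where
    ¡⊤∈M : Dominion.M Dom (proj₁ (proj₁ strict ⊤))
    ¡⊤∈M = EqualityFacts.regular⇒M C Cart Dom Δ∈M eqz
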